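{- For every $n \in \mathbb{N}$ (with $0 \in \mathbb{N}$), $$K_{n+2} = 2\,(J_n + 1),$$ where $K_m$ denotes the number of non-colourable strings of length $m$ over $\{0,1\}$ and $J_n = \frac{2^n - (-1)^n}{3}$ is the $n$-th Jacobsthal number.
   Context: Strings are over the alphabet $\Lambda=\{0,1\}$; $\varepsilon$ is the empty string, $\#w$ is the length of $w$, and $\Lambda^n$ is the set of strings of length $n$. For $\#w\ge 1$ let $l(w)$ be $w$ with its last letter removed and $r(w)$ be $w$ with its first letter removed. Let $T^n$ be the alternating string of length $n$ starting with $0$ (so $T^0=\varepsilon$, $T^n=T^{n-1}0$ for odd $n$ and $T^n=T^{n-1}1$ for even $n\ge 2$), and let $CT^n$ be its letterwise complement ($0\leftrightarrow 1$). Define $\xi:\Lambda^*\to\{ -1,0,1\}$ recursively: $\xi(\varepsilon)=0$; $\xi(w)=1$ if $w=T^k$ for some even $k\ge 2$; $\xi(w)=-1$ if $w=CT^k$ for some even $k\ge 2$; otherwise $\xi(w)=\operatorname{sgn}(\xi(l(w))+\xi(r(w)))$. Define $\phi:\Lambda^*\to\{ -1,0,1\}$ recursively: $\phi(\varepsilon)=0$; $\phi(w)=-1$ if $w=0^k$ with $k$ odd; $\phi(w)=1$ if $w=1^k$ with $k$ odd; otherwise $\phi(w)=\operatorname{sgn}(\phi(r(w))-\phi(l(w)))$. The alternating colouring function is $\psi(w)=\xi(w)^{\#w}\cdot\phi(w)$ (with $0^0=1$). A string $w$ is colourable if $\psi(w)\neq 0$. $K_n=\#\{w\in\Lambda^n:\psi(w)=0\}$.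 -}

module Defs where

open import Data.Bool using (Bool; true; false; not; _∧_; _∨_; if_then_else_)
open import Data.Nat as ℕ using (ℕ; zero; suc)
open import Data.Nat.Properties using () renaming (_≟_ to _≟ℕ_)
open import Data.Integer as ℤ using (ℤ; +_; -[1+_]; -_)
open import Data.Vec using (Vec; []; _∷_; tabulate; map; init; tail; replicate)
open import Data.Vec.Properties using (≡-dec)
open import Data.Bool.Properties using () renaming (_≟_ to _≟B_)
open import Data.Fin using (Fin; toℕ)
open import Data.List using (List; []; _∷_; _++_; length; filter)
import Data.List as L
open import Relation.Nullary using (does)
open import Relation.Binary.PropositionalEquality using (_≡_)
open import Data.Integer.Properties using () renaming (_≟_ to _≟ℤ_)

-- Alphabet Λ = {0,1} encoded as Bool: false = letter 0, true = letter 1.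
-- A string of length n is a  Vec Bool n.
Str : ℕ → Set
Str n = Vec Bool n

sgn : ℤ → ℤ
sgn (+ zero)   = + 0
sgn (+ suc _)  = + 1
sgn -[1+ _ ]   = -[1+ 0 ]

odd : ℕ → Bool
odd zero = false
odd (suc n) = not (odd n)

Tstr : (n : ℕ) → Str n
Tstr n = tabulate (λ i → odd (toℕ i))

CTstr : (n : ℕ) → Str n
CTstr n = map not (Tstr n)

zeros ones : (n : ℕ) → Str n
zeros n = replicate n false
ones  n = replicate n true

_≟S_ : ∀ {n} → (u v : Str n) → Relation.Nullary.Dec (u ≡ v)
_≟S_ = ≡-dec _≟B_

evenGe2 : ℕ → Bool
evenGe2 n = not (odd n) ∧ does (2 ℕ.≤? n)

-- l(w) = init w, r(w) = tail w  (for #w ≥ 1)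
-- ξ, defined by recursion on the length
ξ : (n : ℕ) → Str n → ℤ
ξ zero w = + 0
ξ (suc n) w =
  if evenGe2 (suc n) ∧ does (w ≟S Tstr (suc n)) then + 1
  else if evenGe2 (suc n) ∧ does (w ≟S CTstr (suc n)) then - (+ 1)
  else sgn (ξ n (init w) ℤ.+ ξ n (tail w))

φ : (n : ℕ) → Str n → ℤ
φ zero w = + 0
φ (suc n) w =
  if odd (suc n) ∧ does (w ≟S zeros (suc n)) then - (+ 1)
  else if odd (suc n) ∧ does (w ≟S ones (suc n)) then + 1
  else sgn (φ n (tail w) ℤ.- φ n (init w))

-- alternating colouring function ψ(w) = ξ(w)^{#w} · φ(w)   (ℤ's _^_ has x ^ 0 = 1)
ψ : (n : ℕ) → Str n → ℤ
ψ n w = (ξ n w ℤ.^ n) ℤ.* φ n w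

allStr : (n : ℕ) → List (Str n)
allStr zero = [] ∷ []
allStr (suc n) = L.map (false ∷_) (allStr n) ++ L.map (true ∷_) (allStr n)

-- K_n = number of non-colourable strings of length n (ψ(w) = 0)
K : ℕ → ℕ
K n = length (filter (λ w → ψ n w ≟ℤ + 0) (allStr n))

-- Jacobsthal number J_n = (2^n − (−1)^n) / 3  (exact division in ℤ)
J : ℕ → ℤ
J n = ((+ 2) ℤ.^ n ℤ.- (- (+ 1)) ℤ.^ n) ℤ./ (+ 3)

-- A string is mixed if it is not of the form x y x y … . For mixed c the special cases in the
-- definitions of ξ and φ never apply to x c y, and induction on the length of c gives
-- ξ(x c y) = ξ(c) and φ(x c y) = −φ(c): the step uses ξ(x c y) = sgn(ξ(x c) + ξ(c y)), and the base,
-- where c = p g q with g of period two, is a finite computation, because the values of ξ and φ on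
-- strings α g β with g of period two and |α|, |β| ≤ 2 depend only on the parity of |g| once |g| ≥ 3.
-- As ψ(w) = 0 iff ξ(w) = 0 or φ(w) = 0, writing a string of length n + 4 as a m b with m mixed or of
-- period two gives K(n+4) = 4 K(n+2) − 2 (3 − (−1)^n), which is also the recurrence satisfied by
-- 2 (J(n) + 1) since J(n+2) = 4 J(n) + (−1)^n.
module Submission where

open import Defs
open import Data.Nat using (ℕ; _+_)
open import Data.Integer using (ℤ; +_) renaming (_*_ to _*ℤ_; _+_ to _+ℤ_)
open import Relation.Binary.PropositionalEquality using (_≡_)

open import Algebra.Properties.CommutativeSemigroup using (interchange)
open import Data.Bool using (Bool; true; false; not; _∧_; _∨_; if_then_else_)
import Data.Bool.Properties as Bool
open import Data.Bool.Properties
  using (_≟_; not-involutive; not-injective; ∨-conicalˡ; ∨-conicalʳ; ∧-zeroʳ)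
open import Data.Fin using (toℕ)
import Data.Integer as ℤ
open import Data.Integer using (-[1+_])
open import Data.Integer.DivMod using (div-pos-is-/ℕ)
import Data.Integer.Properties as ℤP
import Data.Integer.Tactic.RingSolver as ℤ-Solver
open import Data.List using (List; []; _∷_; _++_; length; drop; reverse; map; filter; initLast; _∷ʳ′_)
open import Data.List.Properties using (++-assoc; ++-identityʳ; unfold-reverse; map-++; map-∘; map-cong)
open import Data.Nat using (zero; suc; _*_; _≤_; _<_; z≤n; s≤s)
import Data.Nat.DivMod as ℕ
open import Data.Nat.ListAction using (sum)
open import Data.Nat.ListAction.Properties using (sum-++)
open import Data.Nat.Properties
  using (+-comm; *-comm; *-identityˡ; *-distribʳ-+; +-identityʳ; ≤-trans; n≤1+n; suc-injective; allUpTo?;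
         +-commutativeSemigroup)
import Data.Nat.Tactic.RingSolver as ℕ-Solver
open import Data.Product using (∃₂; _×_; _,_)
open import Data.Sum using ([_,_]′)
open import Data.Unit using (tt)
open import Data.Vec using (Vec; toList; init; tail; tabulate; replicate)
import Data.Vec as Vec
open import Data.Vec.Properties using (length-toList; tabulate-∘)
open import Function using (_∘_)
open import Relation.Binary.PropositionalEquality
  using (refl; sym; trans; cong; cong₂; subst; module ≡-Reasoning)
open import Relation.Nullary using (Dec; does; yes; no; _×-dec_; _→-dec_)
open import Relation.Nullary.Decidable using (map′; toWitness; dec-true; dec-false)

open ≡-Reasoning

private
  variable
    A : Set

dropLast : List A → List A
dropLast []          = []
dropLast (x ∷ [])    = []
dropLast (x ∷ y ∷ w) = x ∷ dropLast (y ∷ w)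

length-dropLast : ∀ (x : A) w → length (dropLast (x ∷ w)) ≡ length w
length-dropLast x []      = refl
length-dropLast x (y ∷ w) = cong suc (length-dropLast y w)

dropLast-∷ʳ : ∀ (w : List A) b → dropLast (w ++ b ∷ []) ≡ w
dropLast-∷ʳ []          b = refl
dropLast-∷ʳ (x ∷ [])    b = refl
dropLast-∷ʳ (x ∷ y ∷ w) b = cong (x ∷_) (dropLast-∷ʳ (y ∷ w) b)

dropLast-++ : ∀ (α : List A) z w → dropLast (α ++ z ∷ w) ≡ α ++ dropLast (z ∷ w)
dropLast-++ []          z w = refl
dropLast-++ (a ∷ [])    z w = refl
dropLast-++ (a ∷ b ∷ α) z w = cong (a ∷_) (dropLast-++ (b ∷ α) z w)

dropLast-++-reverse : ∀ (α g : List A) b βr → dropLast (α ++ g ++ reverse (b ∷ βr)) ≡ α ++ g ++ reverse βr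
dropLast-++-reverse α g b βr = begin
  dropLast (α ++ g ++ reverse (b ∷ βr))       ≡⟨ cong (λ r → dropLast (α ++ g ++ r)) (unfold-reverse b βr) ⟩
  dropLast (α ++ g ++ reverse βr ++ b ∷ [])   ≡⟨ cong dropLast reassociate ⟨
  dropLast ((α ++ g ++ reverse βr) ++ b ∷ []) ≡⟨ dropLast-∷ʳ _ b ⟩
  α ++ g ++ reverse βr                        ∎
  where
  reassociate : (α ++ g ++ reverse βr) ++ b ∷ [] ≡ α ++ g ++ reverse βr ++ b ∷ []
  reassociate = trans (++-assoc α _ _) (cong (α ++_) (++-assoc g _ _))

length-∷ʳ : ∀ (w : List A) a → length (w ++ a ∷ []) ≡ suc (length w)
length-∷ʳ []      a = refl
length-∷ʳ (x ∷ w) a = cong suc (length-∷ʳ w a)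

length-insert : ∀ (α : List A) u v w → length (α ++ u ∷ v ∷ w) ≡ 2 + length (α ++ w)
length-insert []      u v w = refl
length-insert (a ∷ α) u v w = cong suc (length-insert α u v w)

𝟙 : Bool → ℕ
𝟙 b = if b then 1 else 0

sum-map-+ : ∀ (f g : A → ℕ) xs → sum (map (λ x → f x + g x) xs) ≡ sum (map f xs) + sum (map g xs)
sum-map-+ f g []       = refl
sum-map-+ f g (x ∷ xs) = trans (cong (_+_ (f x + g x)) (sum-map-+ f g xs))
                               (interchange +-commutativeSemigroup (f x) (g x) _ _)

sum-map-0 : ∀ (xs : List A) → sum (map (λ _ → 0) xs) ≡ 0
sum-map-0 []       = refl
sum-map-0 (x ∷ xs) = sum-map-0 xs

length-filter : ∀ {P : A → Set} (P? : ∀ x → Dec (P x)) xs →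
                length (filter P? xs) ≡ sum (map (𝟙 ∘ does ∘ P?) xs)
length-filter P? []       = refl
length-filter P? (x ∷ xs) with does (P? x)
... | true  = cong suc (length-filter P? xs)
... | false = length-filter P? xs

∀-Bool? : {P : Bool → Set} → (∀ b → Dec (P b)) → Dec (∀ b → P b)
∀-Bool? P? = map′ (λ (f , t) → λ { false → f ; true → t }) (λ h → h false , h true) (P? false ×-dec P? true)

∀-short? : {P : List Bool → Set} → (∀ α → Dec (P α)) → Dec (∀ α → length α ≤ 2 → P α)
∀-short? {P} P? =
  map′ every (λ h → h [] z≤n , (λ a → h (a ∷ []) (s≤s z≤n)) , λ a b → h (a ∷ b ∷ []) (s≤s (s≤s z≤n)))
       (P? [] ×-dec ∀-Bool? (λ a → P? (a ∷ [])) ×-dec ∀-Bool? λ a → ∀-Bool? λ b → P? (a ∷ b ∷ []))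
  where
  every : P [] × (∀ a → P (a ∷ [])) × (∀ a b → P (a ∷ b ∷ [])) → ∀ α → length α ≤ 2 → P α
  every (p₀ , p₁ , p₂) []           _ = p₀
  every (p₀ , p₁ , p₂) (a ∷ [])     _ = p₁ a
  every (p₀ , p₁ , p₂) (a ∷ b ∷ []) _ = p₂ a b
  every _ (a ∷ b ∷ c ∷ α) (s≤s (s≤s ()))

agree-from-2 : ∀ (f g : ℕ → A) → (∀ k → f (5 + k) ≡ f (3 + k)) → (∀ k → g (5 + k) ≡ g (3 + k)) →
               f 2 ≡ g 2 → f 3 ≡ g 3 → f 4 ≡ g 4 → ∀ n → f (2 + n) ≡ g (2 + n)
agree-from-2 f g f-period g-period e₂ e₃ e₄ = go
  where
  go : ∀ n → f (2 + n) ≡ g (2 + n)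
  go 0 = e₂
  go 1 = e₃
  go 2 = e₄
  go (suc (suc (suc k))) = trans (f-period k) (trans (go (suc k)) (sym (g-period k)))

-- Strings of period two

periodicᵛ : Bool → Bool → (n : ℕ) → Vec Bool n
periodicᵛ x y zero    = Vec.[]
periodicᵛ x y (suc n) = x Vec.∷ periodicᵛ y x n

periodic : Bool → Bool → ℕ → List Bool
periodic x y n = toList (periodicᵛ x y n)

isPeriodic : Bool → Bool → List Bool → Bool
isPeriodic x y []      = true
isPeriodic x y (z ∷ w) = does (z ≟ x) ∧ isPeriodic y x w

isPeriodic⇒periodic : ∀ x y w → isPeriodic x y w ≡ true → w ≡ periodic x y (length w)
isPeriodic⇒periodic x y []      e = refl
isPeriodic⇒periodic x y (z ∷ w) e with z ≟ x
... | yes refl = cong (z ∷_) (isPeriodic⇒periodic y x w e)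

aperiodic-++ : ∀ x y w s → isPeriodic x y w ≡ false → isPeriodic x y (w ++ s) ≡ false
aperiodic-++ x y (z ∷ w) s e with z ≟ x
... | yes refl = aperiodic-++ y x w s e
... | no _     = refl

∧-repeat : ∀ a b c → a ∧ (b ∧ (a ∧ (b ∧ c))) ≡ a ∧ (b ∧ c)
∧-repeat true  true  c = refl
∧-repeat true  false c = refl
∧-repeat false b     c = refl

isPeriodic-insert : ∀ x y α u v r →
                    isPeriodic x y (α ++ u ∷ v ∷ u ∷ v ∷ r) ≡ isPeriodic x y (α ++ u ∷ v ∷ r)
isPeriodic-insert x y []      u v r = ∧-repeat (does (u ≟ x)) (does (v ≟ y)) (isPeriodic x y r)
isPeriodic-insert x y (z ∷ α) u v r = cong (does (z ≟ x) ∧_) (isPeriodic-insert y x α u v r)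

dropLast-periodic : ∀ x y n → dropLast (periodic x y (suc n)) ≡ periodic x y n
dropLast-periodic x y zero    = refl
dropLast-periodic x y (suc n) = cong (x ∷_) (dropLast-periodic y x n)

dropLast-++-periodic : ∀ α x y n → dropLast (α ++ periodic x y (suc n) ++ []) ≡ α ++ periodic x y n ++ []
dropLast-++-periodic α x y n
  rewrite ++-identityʳ (periodic x y (suc n)) | ++-identityʳ (periodic x y n)
  = trans (dropLast-++ α x _) (cong (α ++_) (dropLast-periodic x y n))

-- Mixed strings

any₂ : (Bool → Bool → Bool) → Bool
any₂ p = (p false false ∨ p false true) ∨ (p true false ∨ p true true)

any₂-false⁻ : ∀ p → any₂ p ≡ false → ∀ x y → p x y ≡ false
any₂-false⁻ p e false false = ∨-conicalˡ _ (p false true) (∨-conicalˡ (p false false ∨ p false true) _ e)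
any₂-false⁻ p e false true  = ∨-conicalʳ (p false false) _ (∨-conicalˡ (p false false ∨ p false true) _ e)
any₂-false⁻ p e true  false = ∨-conicalˡ _ (p true true) (∨-conicalʳ (p false false ∨ p false true) _ e)
any₂-false⁻ p e true  true  = ∨-conicalʳ (p true false) _ (∨-conicalʳ (p false false ∨ p false true) _ e)

any₂-false⁺ : ∀ p → (∀ x y → p x y ≡ false) → any₂ p ≡ false
any₂-false⁺ p f rewrite f false false | f false true | f true false | f true true = refl

any₂-true⁻ : ∀ p → any₂ p ≡ true → ∃₂ λ x y → p x y ≡ true
any₂-true⁻ p e with p false false in e₁ | p false true in e₂ | p true false in e₃ | p true true in e₄
... | true  | _     | _     | _    = false , false , e₁
... | false | true  | _     | _    = false , true  , e₂
... | false | false | true  | _    = true  , false , e₃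
... | false | false | false | true = true  , true  , e₄

isMixed : List Bool → Bool
isMixed w = not (any₂ λ x y → isPeriodic x y w)

isMixed⇒aperiodic : ∀ {w} → isMixed w ≡ true → ∀ x y → isPeriodic x y w ≡ false
isMixed⇒aperiodic {w} e = any₂-false⁻ (λ x y → isPeriodic x y w) (not-injective e)

aperiodic⇒isMixed : ∀ w → (∀ x y → isPeriodic x y w ≡ false) → isMixed w ≡ true
aperiodic⇒isMixed w f = cong not (any₂-false⁺ (λ x y → isPeriodic x y w) f)

¬isMixed⇒periodic : ∀ w → isMixed w ≡ false → ∃₂ λ x y → w ≡ periodic x y (length w)
¬isMixed⇒periodic w e with any₂-true⁻ (λ x y → isPeriodic x y w) (not-injective e)
... | x , y , p = x , y , isPeriodic⇒periodic x y w p

isMixed-∷ : ∀ a w → isMixed w ≡ true → isMixed (a ∷ w) ≡ true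
isMixed-∷ a w e = aperiodic⇒isMixed (a ∷ w) λ x y →
  trans (cong (does (a ≟ x) ∧_) (isMixed⇒aperiodic {w} e y x)) (∧-zeroʳ _)

isMixed-∷ʳ : ∀ w b → isMixed w ≡ true → isMixed (w ++ b ∷ []) ≡ true
isMixed-∷ʳ w b e = aperiodic⇒isMixed (w ++ b ∷ []) λ x y → aperiodic-++ x y w _ (isMixed⇒aperiodic {w} e x y)

isMixed-short : ∀ w → length w ≤ 2 → isMixed w ≡ false
isMixed-short []                    _ = refl
isMixed-short (false ∷ [])          _ = refl
isMixed-short (true ∷ [])           _ = refl
isMixed-short (false ∷ false ∷ [])  _ = refl
isMixed-short (false ∷ true ∷ [])   _ = refl
isMixed-short (true ∷ false ∷ [])   _ = refl
isMixed-short (true ∷ true ∷ [])    _ = refl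
isMixed-short (a ∷ b ∷ c ∷ w) (s≤s (s≤s ()))

isMixed-insert : ∀ α u v r → isMixed (α ++ u ∷ v ∷ u ∷ v ∷ r) ≡ isMixed (α ++ u ∷ v ∷ r)
isMixed-insert α u v r
  rewrite isPeriodic-insert false false α u v r | isPeriodic-insert false true α u v r
        | isPeriodic-insert true false α u v r | isPeriodic-insert true true α u v r = refl

-- Recursions of the shape of ξ and φ

-- The data of a recursion like ξ or φ: strings of marked length equal to x₁ y₁ x₁ … or x₂ y₂ x₂ … get
-- the value v₁ resp. v₂, all other strings combine the values of their two maximal proper factors.
record Rule : Set where
  field
    marked          : ℕ → Bool
    x₁ y₁ x₂ y₂     : Bool
    v₁ v₂           : ℤ
    combine         : ℤ → ℤ → ℤ
    marked-periodic : ∀ n → marked (4 + n) ≡ marked (2 + n)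

module Triangle (R : Rule) where
  open Rule R

  node : ℕ → List Bool → ℤ → ℤ → ℤ
  node n w a b = if marked n ∧ isPeriodic x₁ y₁ w then v₁
                 else if marked n ∧ isPeriodic x₂ y₂ w then v₂
                 else combine a b

  eval : ℕ → List Bool → ℤ
  eval zero    w = + 0
  eval (suc n) w = node (suc n) w (eval n (dropLast w)) (eval n (drop 1 w))

  -- Opaque so that the type checker evaluates the recursion only where a finite check is intended.
  opaque
    value : List Bool → ℤ
    value w = eval (length w) w

    value-∷ : ∀ x w → value (x ∷ w) ≡ node (suc (length w)) (x ∷ w) (value (dropLast (x ∷ w))) (value w)
    value-∷ x w = cong (λ n → node (suc (length w)) (x ∷ w) (eval n (dropLast (x ∷ w))) (value w))
                       (sym (length-dropLast x w))

    value-toList : ∀ {n} (v : Vec Bool n) → value (toList v) ≡ eval n (toList v)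
    value-toList v = cong (λ m → eval m (toList v)) (length-toList v)

  node-cong : ∀ {m n w w'} a b → marked m ≡ marked n → (∀ x y → isPeriodic x y w ≡ isPeriodic x y w') →
              node m w a b ≡ node n w' a b
  node-cong a b e f rewrite e | f x₁ y₁ | f x₂ y₂ = refl

  value-cong : ∀ {x w y w'} → marked (length (x ∷ w)) ≡ marked (length (y ∷ w')) →
               (∀ u v → isPeriodic u v (x ∷ w) ≡ isPeriodic u v (y ∷ w')) →
               value (dropLast (x ∷ w)) ≡ value (dropLast (y ∷ w')) → value w ≡ value w' →
               value (x ∷ w) ≡ value (y ∷ w')
  value-cong {x} {w} {y} {w'} e f i t = begin
    value (x ∷ w)                                            ≡⟨ value-∷ x w ⟩
    node _ (x ∷ w) (value (dropLast (x ∷ w))) (value w)      ≡⟨ cong₂ (node _ (x ∷ w)) i t ⟩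
    node _ (x ∷ w) (value (dropLast (y ∷ w'))) (value w')    ≡⟨ node-cong {w = x ∷ w} {w' = y ∷ w'} _ _ e f ⟩
    node _ (y ∷ w') (value (dropLast (y ∷ w'))) (value w')   ≡⟨ value-∷ y w' ⟨
    value (y ∷ w')                                           ∎

  value-mixed : ∀ x w → isMixed (x ∷ w) ≡ true → value (x ∷ w) ≡ combine (value (dropLast (x ∷ w))) (value w)
  value-mixed x w e
    rewrite value-∷ x w | isMixed⇒aperiodic {x ∷ w} e x₁ y₁ | isMixed⇒aperiodic {x ∷ w} e x₂ y₂
          | ∧-zeroʳ (marked (suc (length w))) = refl

  marked-insert : ∀ (α : List Bool) u v r →
                  marked (length (α ++ u ∷ v ∷ u ∷ v ∷ r)) ≡ marked (length (α ++ u ∷ v ∷ r))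
  marked-insert α u v r rewrite length-insert α u v (u ∷ v ∷ r) | length-insert α u v r =
    marked-periodic (length (α ++ r))

  value-insert : ∀ (α : List Bool) u v r →
    value (dropLast (α ++ u ∷ v ∷ u ∷ v ∷ r)) ≡ value (dropLast (α ++ u ∷ v ∷ r)) →
    value (drop 1 (α ++ u ∷ v ∷ u ∷ v ∷ r)) ≡ value (drop 1 (α ++ u ∷ v ∷ r)) →
    value (α ++ u ∷ v ∷ u ∷ v ∷ r) ≡ value (α ++ u ∷ v ∷ r)
  value-insert []      u v r = value-cong (marked-insert [] u v r) (λ x y → isPeriodic-insert x y [] u v r)
  value-insert (a ∷ α) u v r =
    value-cong (marked-insert (a ∷ α) u v r) (λ x y → isPeriodic-insert x y (a ∷ α) u v r)

  -- The right context is stored reversed, so that removing its last letter is structural recursion.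
  Pumps : ℕ → Set
  Pumps k = ∀ x y α → length α ≤ 2 → ∀ βr → length βr ≤ 2 →
            value (α ++ periodic x y (5 + k) ++ reverse βr) ≡ value (α ++ periodic x y (3 + k) ++ reverse βr)

  pumps-suc : ∀ {k} → Pumps k → Pumps (suc k)
  pumps-suc {k} pumps-k x y = pump
    where
    shorter : ∀ {n} → suc n ≤ 2 → n ≤ 2
    shorter = ≤-trans (n≤1+n _)

    pump : ∀ α → length α ≤ 2 → ∀ βr → length βr ≤ 2 →
           value (α ++ periodic x y (6 + k) ++ reverse βr) ≡ value (α ++ periodic x y (4 + k) ++ reverse βr)

    pump-dropLast : ∀ α → length α ≤ 2 → ∀ βr → length βr ≤ 2 →
                    value (dropLast (α ++ periodic x y (6 + k) ++ reverse βr)) ≡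
                    value (dropLast (α ++ periodic x y (4 + k) ++ reverse βr))
    pump-dropLast α sα [] _ = begin
      value (dropLast (α ++ periodic x y (6 + k) ++ [])) ≡⟨ cong value (dropLast-++-periodic α x y (5 + k)) ⟩
      value (α ++ periodic x y (5 + k) ++ [])            ≡⟨ pumps-k x y α sα [] z≤n ⟩
      value (α ++ periodic x y (3 + k) ++ [])            ≡⟨ cong value (dropLast-++-periodic α x y (3 + k)) ⟨
      value (dropLast (α ++ periodic x y (4 + k) ++ [])) ∎
    pump-dropLast α sα (b ∷ βr) sβ = begin
      value (dropLast (α ++ periodic x y (6 + k) ++ reverse (b ∷ βr)))
        ≡⟨ cong value (dropLast-++-reverse α _ b βr) ⟩
      value (α ++ periodic x y (6 + k) ++ reverse βr)
        ≡⟨ pump α sα βr (shorter sβ) ⟩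
      value (α ++ periodic x y (4 + k) ++ reverse βr)
        ≡⟨ cong value (dropLast-++-reverse α _ b βr) ⟨
      value (dropLast (α ++ periodic x y (4 + k) ++ reverse (b ∷ βr)))
        ∎

    pump-drop1 : ∀ α → length α ≤ 2 → ∀ βr → length βr ≤ 2 →
                 value (drop 1 (α ++ periodic x y (6 + k) ++ reverse βr)) ≡
                 value (drop 1 (α ++ periodic x y (4 + k) ++ reverse βr))
    pump-drop1 []      _  βr sβ = pumps-k y x [] z≤n βr sβ
    pump-drop1 (a ∷ α) sα βr sβ = pump α (shorter sα) βr sβ

    pump α sα βr sβ = value-insert α x y (periodic x y (2 + k) ++ reverse βr)
                                   (pump-dropLast α sα βr sβ) (pump-drop1 α sα βr sβ)

  pumps : Pumps 0 → ∀ k → Pumps k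
  pumps base zero    = base
  pumps base (suc k) = pumps-suc (pumps base k)

  pumps₀? : Dec (Pumps 0)
  pumps₀? = ∀-Bool? λ x → ∀-Bool? λ y → ∀-short? λ α → ∀-short? λ βr →
    value (α ++ periodic x y 5 ++ reverse βr) ℤ.≟ value (α ++ periodic x y 3 ++ reverse βr)

  module Framing (σ : ℤ → ℤ) (σ-combine : ∀ a b → combine (σ a) (σ b) ≡ σ (combine a b)) where

    Framed : List Bool → Set
    Framed c = ∀ x y → value (x ∷ c ++ y ∷ []) ≡ σ (value c)

    Frames : ℕ → Set
    Frames k = ∀ p u v q → isMixed (p ∷ periodic u v k ++ q ∷ []) ≡ true →
               Framed (p ∷ periodic u v k ++ q ∷ [])

    frames₀? : Dec (∀ {k} → k < 4 → Frames (suc k))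
    frames₀? = allUpTo? (λ k → ∀-Bool? λ p → ∀-Bool? λ u → ∀-Bool? λ v → ∀-Bool? λ q →
      let c = p ∷ periodic u v (suc k) ++ q ∷ [] in
      (isMixed c Bool.≟ true) →-dec ∀-Bool? λ x → ∀-Bool? λ y → value (x ∷ c ++ y ∷ []) ℤ.≟ σ (value c)) 4

    frames : (∀ k → Pumps k) → (∀ {k} → k < 4 → Frames (suc k)) → ∀ k → Frames (suc k)
    frames pumps frames₀ = go
      where
      go : ∀ k → Frames (suc k)
      go 0 = frames₀ (s≤s z≤n)
      go 1 = frames₀ (s≤s (s≤s z≤n))
      go 2 = frames₀ (s≤s (s≤s (s≤s z≤n)))
      go 3 = frames₀ (s≤s (s≤s (s≤s (s≤s z≤n))))
      go (suc (suc (suc (suc k)))) p u v q mix x y = begin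
        value (x ∷ (p ∷ periodic u v (5 + k) ++ q ∷ []) ++ y ∷ [])
          ≡⟨ cong (λ w → value (x ∷ p ∷ w)) (++-assoc (periodic u v (5 + k)) _ _) ⟩
        value (x ∷ p ∷ periodic u v (5 + k) ++ q ∷ y ∷ [])
          ≡⟨ pumps k u v (x ∷ p ∷ []) (s≤s (s≤s z≤n)) (y ∷ q ∷ []) (s≤s (s≤s z≤n)) ⟩
        value (x ∷ p ∷ periodic u v (3 + k) ++ q ∷ y ∷ [])
          ≡⟨ cong (λ w → value (x ∷ p ∷ w)) (++-assoc (periodic u v (3 + k)) _ _) ⟨
        value (x ∷ (p ∷ periodic u v (3 + k) ++ q ∷ []) ++ y ∷ [])
          ≡⟨ go (suc (suc k)) p u v q mix′ x y ⟩
        σ (value (p ∷ periodic u v (3 + k) ++ q ∷ []))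
          ≡⟨ cong σ (pumps k u v (p ∷ []) (s≤s z≤n) (q ∷ []) (s≤s z≤n)) ⟨
        σ (value (p ∷ periodic u v (5 + k) ++ q ∷ []))
          ∎
        where
        mix′ : isMixed (p ∷ periodic u v (3 + k) ++ q ∷ []) ≡ true
        mix′ = trans (sym (isMixed-insert (p ∷ []) u v (periodic u v (1 + k) ++ q ∷ []))) mix

    framed-mixed : ∀ p m q → isMixed (p ∷ m ++ q ∷ []) ≡ true →
                   Framed (p ∷ m) → Framed (m ++ q ∷ []) → Framed (p ∷ m ++ q ∷ [])
    framed-mixed p m q mix init-framed tail-framed x y = begin
      value (x ∷ c ++ y ∷ [])
        ≡⟨ value-mixed x (c ++ y ∷ []) (isMixed-∷ x (c ++ y ∷ []) (isMixed-∷ʳ c y mix)) ⟩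
      combine (value (dropLast (x ∷ c ++ y ∷ []))) (value (c ++ y ∷ []))
        ≡⟨ cong (λ w → combine (value w) (value (c ++ y ∷ []))) (dropLast-∷ʳ (x ∷ c) y) ⟩
      combine (value (x ∷ c)) (value (c ++ y ∷ []))
        ≡⟨ cong₂ combine (init-framed x q) (tail-framed p y) ⟩
      combine (σ (value (p ∷ m))) (σ (value (m ++ q ∷ [])))
        ≡⟨ σ-combine _ _ ⟩
      σ (combine (value (p ∷ m)) (value (m ++ q ∷ [])))
        ≡⟨ cong (λ w → σ (combine (value w) (value (m ++ q ∷ [])))) (dropLast-∷ʳ (p ∷ m) q) ⟨
      σ (combine (value (dropLast c)) (value (m ++ q ∷ [])))
        ≡⟨ cong σ (value-mixed p (m ++ q ∷ []) mix) ⟨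
      σ (value c)
        ∎
      where
      c = p ∷ m ++ q ∷ []

    module _ (frames-all : ∀ k → Frames (suc k)) where

      framed : ∀ n p m q → length m ≡ n → isMixed (p ∷ m ++ q ∷ []) ≡ true → Framed (p ∷ m ++ q ∷ [])
      framed zero p [] q refl mix with () ← trans (sym mix) (isMixed-short (p ∷ q ∷ []) (s≤s (s≤s z≤n)))
      framed (suc n) p m q len mix with isMixed m in mixed-m
      ... | false with ¬isMixed⇒periodic m mixed-m
      ...   | u , v , m≡ = subst (λ m → isMixed (p ∷ m ++ q ∷ []) ≡ true → Framed (p ∷ m ++ q ∷ []))
                                 (sym (trans m≡ (cong (periodic u v) len))) (frames-all n p u v q) mix
      framed (suc n) p m q len mix | true with initLast m
      ... | [] ∷ʳ′ q₀ with () ← trans (sym mixed-m) (isMixed-short (q₀ ∷ []) (s≤s z≤n))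
      ... | (z ∷ m₁) ∷ʳ′ q₀ =
        framed-mixed p _ q mix
          (framed n p (z ∷ m₁) q₀ (suc-injective (trans (sym (length-∷ʳ (z ∷ m₁) q₀)) len))
                  (isMixed-∷ p m mixed-m))
          (framed n z (m₁ ++ q₀ ∷ []) q (suc-injective len) (isMixed-∷ʳ m q mixed-m))

      value-framed : ∀ c → isMixed c ≡ true → Framed c
      value-framed (p ∷ r) mix with initLast r
      ... | [] with () ← trans (sym mix) (isMixed-short (p ∷ []) (s≤s z≤n))
      ... | m ∷ʳ′ q = framed (length m) p m q refl mix

ξ-rule : Rule
ξ-rule = record
  { marked = evenGe2 ; x₁ = false ; y₁ = true ; v₁ = + 1 ; x₂ = true ; y₂ = false ; v₂ = ℤ.- (+ 1)
  ; combine = λ a b → sgn (a ℤ.+ b)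
  ; marked-periodic = λ n → cong (λ b → not b ∧ true) (not-involutive (odd (2 + n))) }

φ-rule : Rule
φ-rule = record
  { marked = odd ; x₁ = false ; y₁ = false ; v₁ = ℤ.- (+ 1) ; x₂ = true ; y₂ = true ; v₂ = + 1
  ; combine = λ a b → sgn (b ℤ.- a)
  ; marked-periodic = λ n → not-involutive (odd (2 + n)) }

module Ξ = Triangle ξ-rule
module Φ = Triangle φ-rule

≟-periodicᵛ : ∀ {n} x y (v : Vec Bool n) → does (v ≟S periodicᵛ x y n) ≡ isPeriodic x y (toList v)
≟-periodicᵛ x y Vec.[]        = refl
≟-periodicᵛ x y (z Vec.∷ v) = cong (does (z ≟ x) ∧_) (≟-periodicᵛ y x v)

tabulate-odd : ∀ n (f : Bool → Bool) → tabulate (λ i → f (odd (toℕ i))) ≡ periodicᵛ (f false) (f true) n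
tabulate-odd zero    f = refl
tabulate-odd (suc n) f = cong (f false Vec.∷_) (tabulate-odd n (f ∘ not))

Tstr≡periodicᵛ : ∀ n → Tstr n ≡ periodicᵛ false true n
Tstr≡periodicᵛ n = tabulate-odd n (λ b → b)

CTstr≡periodicᵛ : ∀ n → CTstr n ≡ periodicᵛ true false n
CTstr≡periodicᵛ n = trans (sym (tabulate-∘ not _)) (tabulate-odd n not)

replicate≡periodicᵛ : ∀ n x → replicate n x ≡ periodicᵛ x x n
replicate≡periodicᵛ zero    x = refl
replicate≡periodicᵛ (suc n) x = cong (x Vec.∷_) (replicate≡periodicᵛ n x)

toList-init : ∀ {n} (v : Vec Bool (suc n)) → toList (init v) ≡ dropLast (toList v)
toList-init (x Vec.∷ Vec.[])        = refl
toList-init (x Vec.∷ y Vec.∷ v) = cong (x ∷_) (toList-init (y Vec.∷ v))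

ξ≡eval : ∀ n (v : Str n) → ξ n v ≡ Ξ.eval n (toList v)
ξ≡eval zero    v = refl
ξ≡eval (suc n) v
  rewrite Tstr≡periodicᵛ (suc n) | CTstr≡periodicᵛ (suc n)
        | ≟-periodicᵛ false true v | ≟-periodicᵛ true false v
        | ξ≡eval n (init v) | ξ≡eval n (tail v) | toList-init v
  with v
... | x Vec.∷ w = refl

φ≡eval : ∀ n (v : Str n) → φ n v ≡ Φ.eval n (toList v)
φ≡eval zero    v = refl
φ≡eval (suc n) v
  rewrite replicate≡periodicᵛ (suc n) false | replicate≡periodicᵛ (suc n) true
        | ≟-periodicᵛ false false v | ≟-periodicᵛ true true v
        | φ≡eval n (init v) | φ≡eval n (tail v) | toList-init v
  with v
... | x Vec.∷ w = refl

ξ≡value : ∀ {n} (v : Str n) → ξ n v ≡ Ξ.value (toList v)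
ξ≡value {n} v = trans (ξ≡eval n v) (sym (Ξ.value-toList v))

φ≡value : ∀ {n} (v : Str n) → φ n v ≡ Φ.value (toList v)
φ≡value {n} v = trans (φ≡eval n v) (sym (Φ.value-toList v))

sgn-neg : ∀ x → sgn (ℤ.- x) ≡ ℤ.- sgn x
sgn-neg (+ zero)  = refl
sgn-neg (+ suc n) = refl
sgn-neg -[1+ n ]  = refl

φ-combine-neg : ∀ a b → sgn (ℤ.- b ℤ.- ℤ.- a) ≡ ℤ.- sgn (b ℤ.- a)
φ-combine-neg a b = trans (cong sgn (sym (ℤP.neg-distrib-+ b (ℤ.- a)))) (sgn-neg (b ℤ.- a))

module ΞF = Ξ.Framing (λ a → a) (λ a b → refl)
module ΦF = Φ.Framing ℤ.-_ φ-combine-neg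

opaque
  unfolding Triangle.value

  ξ-pumps₀ : Ξ.Pumps 0
  ξ-pumps₀ = toWitness {a? = Ξ.pumps₀?} tt

  φ-pumps₀ : Φ.Pumps 0
  φ-pumps₀ = toWitness {a? = Φ.pumps₀?} tt

  ξ-frames₀ : ∀ {k} → k < 4 → ΞF.Frames (suc k)
  ξ-frames₀ = toWitness {a? = ΞF.frames₀?} tt

  φ-frames₀ : ∀ {k} → k < 4 → ΦF.Frames (suc k)
  φ-frames₀ = toWitness {a? = ΦF.frames₀?} tt

ξ-pumps : ∀ k → Ξ.Pumps k
ξ-pumps = Ξ.pumps ξ-pumps₀

φ-pumps : ∀ k → Φ.Pumps k
φ-pumps = Φ.pumps φ-pumps₀

ξ-framed : ∀ c → isMixed c ≡ true → ΞF.Framed c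
ξ-framed = ΞF.value-framed (ΞF.frames ξ-pumps ξ-frames₀)

φ-framed : ∀ c → isMixed c ≡ true → ΦF.Framed c
φ-framed = ΦF.value-framed (ΦF.frames φ-pumps φ-frames₀)

-- Counting vanishing strings

∑₂ : (Bool → Bool → ℕ) → ℕ
∑₂ f = (f false false + f false true) + (f true false + f true true)

∑₂-cong : ∀ {f g} → (∀ x y → f x y ≡ g x y) → ∑₂ f ≡ ∑₂ g
∑₂-cong e = cong₂ _+_ (cong₂ _+_ (e false false) (e false true)) (cong₂ _+_ (e true false) (e true true))

∑₂-*ʳ : ∀ f c → ∑₂ f * c ≡ ∑₂ (λ x y → f x y * c)
∑₂-*ʳ f c = trans (*-distribʳ-+ c (f false false + f false true) _)
                  (cong₂ _+_ (*-distribʳ-+ c (f false false) _) (*-distribʳ-+ c (f true false) _))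

∑₂-const-+ : ∀ m f → ∑₂ (λ a b → m + f a b) ≡ 4 * m + ∑₂ f
∑₂-const-+ m f = rearrange m (f false false) (f false true) (f true false) (f true true)
  where
  rearrange : ∀ m a b c d → ((m + a) + (m + b)) + ((m + c) + (m + d)) ≡ 4 * m + ((a + b) + (c + d))
  rearrange = ℕ-Solver.solve-∀

∑ : ℕ → (List Bool → ℕ) → ℕ
∑ n f = sum (map (f ∘ toList) (allStr n))

∑-suc : ∀ n f → ∑ (suc n) f ≡ ∑ n (f ∘ (false ∷_)) + ∑ n (f ∘ (true ∷_))
∑-suc n f = begin
  sum (map g (map (false Vec.∷_) vs ++ map (true Vec.∷_) vs))
    ≡⟨ cong sum (map-++ g (map (false Vec.∷_) vs) _) ⟩
  sum (map g (map (false Vec.∷_) vs) ++ map g (map (true Vec.∷_) vs))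
    ≡⟨ sum-++ (map g (map (false Vec.∷_) vs)) _ ⟩
  sum (map g (map (false Vec.∷_) vs)) + sum (map g (map (true Vec.∷_) vs))
    ≡⟨ cong₂ _+_ (cong sum (map-∘ vs)) (cong sum (map-∘ vs)) ⟨
  ∑ n (f ∘ (false ∷_)) + ∑ n (f ∘ (true ∷_))
    ∎
  where
  vs = allStr n
  g = f ∘ toList

∑-cong : ∀ n f g → (∀ (v : Str n) → f (toList v) ≡ g (toList v)) → ∑ n f ≡ ∑ n g
∑-cong n f g e = cong sum (map-cong e (allStr n))

∑-+ : ∀ n f g → ∑ n (λ w → f w + g w) ≡ ∑ n f + ∑ n g
∑-+ n f g = sum-map-+ (f ∘ toList) (g ∘ toList) (allStr n)

∑-0 : ∀ n → ∑ n (λ _ → 0) ≡ 0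
∑-0 n = sum-map-0 (allStr n)

∑-∑₂ : ∀ n (f : Bool → Bool → List Bool → ℕ) → ∑ n (λ w → ∑₂ (λ x y → f x y w)) ≡ ∑₂ (λ x y → ∑ n (f x y))
∑-∑₂ n f = trans (∑-+ n (λ w → f false false w + f false true w) (λ w → f true false w + f true true w))
                 (cong₂ _+_ (∑-+ n (f false false) (f false true)) (∑-+ n (f true false) (f true true)))

∑-∷ʳ : ∀ n f → ∑ (suc n) f ≡ ∑ n (λ w → f (w ++ false ∷ [])) + ∑ n (λ w → f (w ++ true ∷ []))
∑-∷ʳ zero    f = ∑-suc zero f
∑-∷ʳ (suc n) f = begin
  ∑ (2 + n) f
    ≡⟨ ∑-suc (suc n) f ⟩
  ∑ (1 + n) (λ w → f (false ∷ w)) + ∑ (1 + n) (λ w → f (true ∷ w))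
    ≡⟨ cong₂ _+_ (∑-∷ʳ n (λ w → f (false ∷ w))) (∑-∷ʳ n (λ w → f (true ∷ w))) ⟩
  (S false false + S false true) + (S true false + S true true)
    ≡⟨ interchange +-commutativeSemigroup (S false false) (S false true) (S true false) (S true true) ⟩
  (S false false + S true false) + (S false true + S true true)
    ≡⟨ cong₂ _+_ (∑-suc n (λ w → f (w ++ false ∷ []))) (∑-suc n (λ w → f (w ++ true ∷ []))) ⟨
  ∑ (1 + n) (λ w → f (w ++ false ∷ [])) + ∑ (1 + n) (λ w → f (w ++ true ∷ []))
    ∎
  where
  S : Bool → Bool → ℕ
  S a b = ∑ n (λ w → f (a ∷ w ++ b ∷ []))

∑-periodic : ∀ n x y (h : List Bool → ℕ) → ∑ n (λ w → 𝟙 (isPeriodic x y w) * h w) ≡ h (periodic x y n)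
∑-periodic zero    x     y h = trans (+-identityʳ _) (+-identityʳ _)
∑-periodic (suc n) false y h = begin
  ∑ (suc n) (λ w → 𝟙 (isPeriodic false y w) * h w)
    ≡⟨ ∑-suc n (λ w → 𝟙 (isPeriodic false y w) * h w) ⟩
  ∑ n (λ w → 𝟙 (isPeriodic y false w) * h (false ∷ w)) + ∑ n (λ _ → 0)
    ≡⟨ cong₂ _+_ (∑-periodic n y false (λ w → h (false ∷ w))) (∑-0 n) ⟩
  h (periodic false y (suc n)) + 0
    ≡⟨ +-identityʳ _ ⟩
  h (periodic false y (suc n))
    ∎
∑-periodic (suc n) true  y h = begin
  ∑ (suc n) (λ w → 𝟙 (isPeriodic true y w) * h w)
    ≡⟨ ∑-suc n (λ w → 𝟙 (isPeriodic true y w) * h w) ⟩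
  ∑ n (λ _ → 0) + ∑ n (λ w → 𝟙 (isPeriodic y true w) * h (true ∷ w))
    ≡⟨ cong₂ _+_ (∑-0 n) (∑-periodic n y true (λ w → h (true ∷ w))) ⟩
  h (periodic true y (suc n))
    ∎

partition : ∀ a b r → 𝟙 (isMixed (a ∷ b ∷ r)) + ∑₂ (λ x y → 𝟙 (isPeriodic x y (a ∷ b ∷ r))) ≡ 1
partition false false r with isPeriodic false false r
... | false = refl
... | true  = refl
partition false true  r with isPeriodic false true r
... | false = refl
... | true  = refl
partition true  false r with isPeriodic true false r
... | false = refl
... | true  = refl
partition true  true  r with isPeriodic true true r
... | false = refl
... | true  = refl

∑-split : ∀ n (h : List Bool → ℕ) →
          ∑ (2 + n) h ≡ ∑ (2 + n) (λ w → 𝟙 (isMixed w) * h w) + ∑₂ (λ x y → h (periodic x y (2 + n)))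
∑-split n h = begin
  ∑ (2 + n) h
    ≡⟨ ∑-cong (2 + n) h (λ w → mixedPart w + periodicPart w) split ⟩
  ∑ (2 + n) (λ w → mixedPart w + periodicPart w)
    ≡⟨ ∑-+ (2 + n) mixedPart periodicPart ⟩
  ∑ (2 + n) mixedPart + ∑ (2 + n) periodicPart
    ≡⟨ cong (_+_ (∑ (2 + n) mixedPart)) (∑-∑₂ (2 + n) (λ x y w → 𝟙 (isPeriodic x y w) * h w)) ⟩
  ∑ (2 + n) mixedPart + ∑₂ (λ x y → ∑ (2 + n) (λ w → 𝟙 (isPeriodic x y w) * h w))
    ≡⟨ cong (_+_ (∑ (2 + n) mixedPart)) (∑₂-cong λ x y → ∑-periodic (2 + n) x y h) ⟩
  ∑ (2 + n) mixedPart + ∑₂ (λ x y → h (periodic x y (2 + n)))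
    ∎
  where
  mixedPart periodicPart : List Bool → ℕ
  mixedPart w = 𝟙 (isMixed w) * h w
  periodicPart w = ∑₂ (λ x y → 𝟙 (isPeriodic x y w) * h w)

  split : ∀ (v : Str (2 + n)) → h (toList v) ≡ mixedPart (toList v) + periodicPart (toList v)
  split (a Vec.∷ b Vec.∷ v) = begin
    h w
      ≡⟨ *-identityˡ (h w) ⟨
    1 * h w
      ≡⟨ cong (_* h w) (partition a b (toList v)) ⟨
    (𝟙 (isMixed w) + ∑₂ (λ x y → 𝟙 (isPeriodic x y w))) * h w
      ≡⟨ *-distribʳ-+ (h w) (𝟙 (isMixed w)) (∑₂ (λ x y → 𝟙 (isPeriodic x y w))) ⟩
    mixedPart w + ∑₂ (λ x y → 𝟙 (isPeriodic x y w)) * h w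
      ≡⟨ cong (_+_ (mixedPart w)) (∑₂-*ʳ (λ x y → 𝟙 (isPeriodic x y w)) (h w)) ⟩
    mixedPart w + periodicPart w
      ∎
    where
    w = a ∷ b ∷ toList v

isZero : ℤ → Bool
isZero z = does (z ℤP.≟ + 0)

isZero-neg : ∀ z → isZero (ℤ.- z) ≡ isZero z
isZero-neg (+ zero)  = refl
isZero-neg (+ suc n) = refl
isZero-neg -[1+ n ]  = refl

isZero-^* : ∀ n a b → isZero ((a ℤ.^ suc n) ℤ.* b) ≡ does (a ℤP.≟ + 0) ∨ does (b ℤP.≟ + 0)
isZero-^* n a b with a ℤP.≟ + 0 | b ℤP.≟ + 0
... | yes refl | _        = dec-true (_ ℤP.≟ + 0)
                                     (trans (cong (ℤ._* b) (ℤP.*-zeroˡ ((+ 0) ℤ.^ n))) (ℤP.*-zeroˡ b))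
... | no _     | yes refl = dec-true (_ ℤP.≟ + 0) (ℤP.*-zeroʳ (a ℤ.^ suc n))
... | no a≢0   | no b≢0   = dec-false (_ ℤP.≟ + 0) λ ab≡0 →
  [ a≢0 ∘ ℤP.i^n≡0⇒i≡0 a (suc n) , b≢0 ]′ (ℤP.i*j≡0⇒i≡0∨j≡0 (a ℤ.^ suc n) ab≡0)

vanishes : List Bool → Bool
vanishes w = isZero (Ξ.value w) ∨ isZero (Φ.value w)

ψ-vanishes : ∀ n (v : Str (suc n)) → isZero (ψ (suc n) v) ≡ vanishes (toList v)
ψ-vanishes n v = trans (isZero-^* n (ξ (suc n) v) (φ (suc n) v))
                       (cong₂ _∨_ (cong isZero (ξ≡value v)) (cong isZero (φ≡value v)))

vanishes-framed : ∀ x c y → isMixed c ≡ true → vanishes (x ∷ c ++ y ∷ []) ≡ vanishes c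
vanishes-framed x c y mix = cong₂ _∨_ (cong isZero (ξ-framed c mix x y))
                                      (trans (cong isZero (φ-framed c mix x y)) (isZero-neg (Φ.value c)))

vanishes-pumps : ∀ k x y α → length α ≤ 2 → ∀ βr → length βr ≤ 2 →
  vanishes (α ++ periodic x y (5 + k) ++ reverse βr) ≡ vanishes (α ++ periodic x y (3 + k) ++ reverse βr)
vanishes-pumps k x y α sα βr sβ =
  cong₂ _∨_ (cong isZero (ξ-pumps k x y α sα βr sβ)) (cong isZero (φ-pumps k x y α sα βr sβ))

zeroCount : ℕ → ℕ
zeroCount n = ∑ n (𝟙 ∘ vanishes)

mixedZeroCount : ℕ → ℕ
mixedZeroCount n = ∑ n (λ w → 𝟙 (isMixed w) * 𝟙 (vanishes w))

periodicZeroCount : ℕ → ℕ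
periodicZeroCount n = ∑₂ λ x y → 𝟙 (vanishes (periodic x y n))

framedPeriodicZeroCount : ℕ → ℕ
framedPeriodicZeroCount n = ∑₂ λ a b → ∑₂ λ x y → 𝟙 (vanishes (a ∷ periodic x y n ++ b ∷ []))

K≡zeroCount : ∀ n → K (suc n) ≡ zeroCount (suc n)
K≡zeroCount n = trans (length-filter (λ w → ψ (suc n) w ℤP.≟ + 0) (allStr (suc n)))
                      (cong sum (map-cong (λ v → cong 𝟙 (ψ-vanishes n v)) (allStr (suc n))))

zeroCount-split : ∀ n → zeroCount (2 + n) ≡ mixedZeroCount (2 + n) + periodicZeroCount (2 + n)
zeroCount-split n = ∑-split n (𝟙 ∘ vanishes)

zeroCount-split-framed : ∀ n →
  zeroCount (4 + n) ≡ 4 * mixedZeroCount (2 + n) + framedPeriodicZeroCount (2 + n)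
zeroCount-split-framed n = begin
  zeroCount (4 + n)
    ≡⟨ ∑-suc (3 + n) (𝟙 ∘ vanishes) ⟩
  ∑ (3 + n) (λ w → 𝟙 (vanishes (false ∷ w))) + ∑ (3 + n) (λ w → 𝟙 (vanishes (true ∷ w)))
    ≡⟨ cong₂ _+_ (∑-∷ʳ (2 + n) (λ w → 𝟙 (vanishes (false ∷ w))))
                 (∑-∷ʳ (2 + n) (λ w → 𝟙 (vanishes (true ∷ w)))) ⟩
  ∑₂ (λ a b → ∑ (2 + n) (λ w → 𝟙 (vanishes (a ∷ w ++ b ∷ []))))
    ≡⟨ ∑₂-cong framed ⟩
  ∑₂ (λ a b → M + F a b)
    ≡⟨ ∑₂-const-+ M F ⟩
  4 * M + framedPeriodicZeroCount (2 + n)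
    ∎
  where
  M = mixedZeroCount (2 + n)

  F : Bool → Bool → ℕ
  F a b = ∑₂ λ x y → 𝟙 (vanishes (a ∷ periodic x y (2 + n) ++ b ∷ []))

  mixed-framed : ∀ a b w → 𝟙 (isMixed w) * 𝟙 (vanishes (a ∷ w ++ b ∷ [])) ≡ 𝟙 (isMixed w) * 𝟙 (vanishes w)
  mixed-framed a b w with isMixed w in mix
  ... | true  = cong (λ z → 𝟙 z + 0) (vanishes-framed a w b mix)
  ... | false = refl

  framed : ∀ a b → ∑ (2 + n) (λ w → 𝟙 (vanishes (a ∷ w ++ b ∷ []))) ≡ M + F a b
  framed a b = trans (∑-split n (λ w → 𝟙 (vanishes (a ∷ w ++ b ∷ []))))
                     (cong (_+ F a b) (∑-cong (2 + n) (λ w → 𝟙 (isMixed w) * 𝟙 (vanishes (a ∷ w ++ b ∷ [])))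
                                                      (λ w → 𝟙 (isMixed w) * 𝟙 (vanishes w))
                                                      (λ v → mixed-framed a b (toList v))))

periodicZeroCount-pumps : ∀ k → periodicZeroCount (5 + k) ≡ periodicZeroCount (3 + k)
periodicZeroCount-pumps k = ∑₂-cong λ x y → cong 𝟙 (begin
  vanishes (periodic x y (5 + k))       ≡⟨ cong vanishes (++-identityʳ _) ⟨
  vanishes (periodic x y (5 + k) ++ []) ≡⟨ vanishes-pumps k x y [] z≤n [] z≤n ⟩
  vanishes (periodic x y (3 + k) ++ []) ≡⟨ cong vanishes (++-identityʳ _) ⟩
  vanishes (periodic x y (3 + k))       ∎)

framedPeriodicZeroCount-pumps : ∀ k → framedPeriodicZeroCount (5 + k) ≡ framedPeriodicZeroCount (3 + k)
framedPeriodicZeroCount-pumps k = ∑₂-cong λ a b → ∑₂-cong λ x y →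
  cong 𝟙 (vanishes-pumps k x y (a ∷ []) (s≤s z≤n) (b ∷ []) (s≤s z≤n))

-1^_ : ℕ → ℤ
-1^ n = (ℤ.- + 1) ℤ.^ n

-1^[2+n]≡-1^n : ∀ n → -1^ (2 + n) ≡ -1^ n
-1^[2+n]≡-1^n n = trans (ℤP.-1*i≡-i _) (trans (cong ℤ.-_ (ℤP.-1*i≡-i _)) (ℤP.neg-involutive _))

opaque
  unfolding Triangle.value

  periodicZeroCount-value : ∀ n → + periodicZeroCount (2 + n) ≡ + 3 ℤ.- -1^ n
  periodicZeroCount-value n =
    trans (agree-from-2 (λ m → + periodicZeroCount m) (λ m → + 3 ℤ.- -1^ m)
                        (λ k → cong +_ (periodicZeroCount-pumps k))
                        (λ k → cong (λ s → + 3 ℤ.- s) (-1^[2+n]≡-1^n (3 + k)))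
                        refl refl refl n)
          (cong (λ s → + 3 ℤ.- s) (-1^[2+n]≡-1^n n))

  framedPeriodicZeroCount-double : ∀ n → framedPeriodicZeroCount (2 + n) ≡ 2 * periodicZeroCount (2 + n)
  framedPeriodicZeroCount-double =
    agree-from-2 framedPeriodicZeroCount (λ m → 2 * periodicZeroCount m)
                 framedPeriodicZeroCount-pumps (λ k → cong (2 *_) (periodicZeroCount-pumps k)) refl refl refl

zeroCount-recurrence : ∀ n → zeroCount (4 + n) + 2 * periodicZeroCount (2 + n) ≡ 4 * zeroCount (2 + n)
zeroCount-recurrence n
  rewrite zeroCount-split-framed n | zeroCount-split n | framedPeriodicZeroCount-double n =
  rearrange (mixedZeroCount (2 + n)) (periodicZeroCount (2 + n))
  where
  rearrange : ∀ m s → (4 * m + 2 * s) + 2 * s ≡ 4 * (m + s)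
  rearrange = ℕ-Solver.solve-∀

sum⇒difference : ∀ {m n p} → m + n ≡ p → + m ≡ + p ℤ.- + n
sum⇒difference {m} {n} {p} e = begin
  + m                     ≡⟨ cancel (+ m) (+ n) ⟩
  (+ m +ℤ + n) ℤ.- + n    ≡⟨ cong (ℤ._- + n) (ℤP.pos-+ m n) ⟨
  + (m + n) ℤ.- + n       ≡⟨ cong (λ k → + k ℤ.- + n) e ⟩
  + p ℤ.- + n             ∎
  where
  cancel : ∀ a b → a ≡ (a +ℤ b) ℤ.- b
  cancel = ℤ-Solver.solve-∀

K-recurrence : ∀ n → + K (4 + n) ≡ + 4 *ℤ + K (2 + n) ℤ.- + 2 *ℤ (+ 3 ℤ.- -1^ n)
K-recurrence n = begin
  + K (4 + n)
    ≡⟨ cong +_ (K≡zeroCount (3 + n)) ⟩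
  + zeroCount (4 + n)
    ≡⟨ sum⇒difference (zeroCount-recurrence n) ⟩
  + (4 * zeroCount (2 + n)) ℤ.- + (2 * periodicZeroCount (2 + n))
    ≡⟨ cong₂ ℤ._-_ (ℤP.pos-* 4 (zeroCount (2 + n))) (ℤP.pos-* 2 (periodicZeroCount (2 + n))) ⟩
  + 4 *ℤ + zeroCount (2 + n) ℤ.- + 2 *ℤ + periodicZeroCount (2 + n)
    ≡⟨ cong₂ (λ k s → + 4 *ℤ + k ℤ.- + 2 *ℤ s) (sym (K≡zeroCount (1 + n))) (periodicZeroCount-value n) ⟩
  + 4 *ℤ + K (2 + n) ℤ.- + 2 *ℤ (+ 3 ℤ.- -1^ n)
    ∎

-- Jacobsthal numbers

jacobsthal : ℕ → ℕ
jacobsthal 0             = 0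
jacobsthal 1             = 1
jacobsthal (suc (suc n)) = jacobsthal (suc n) + 2 * jacobsthal n

jacobsthal-suc : ∀ n → + jacobsthal (suc n) ≡ + 2 *ℤ + jacobsthal n +ℤ -1^ n
jacobsthal-suc zero    = refl
jacobsthal-suc (suc n) = begin
  + (jacobsthal (suc n) + 2 * jacobsthal n)
    ≡⟨ trans (ℤP.pos-+ (jacobsthal (suc n)) _) (cong (+ jacobsthal (suc n) +ℤ_) (ℤP.pos-* 2 (jacobsthal n))) ⟩
  + jacobsthal (suc n) +ℤ + 2 *ℤ j
    ≡⟨ cong (_+ℤ + 2 *ℤ j) (jacobsthal-suc n) ⟩
  (+ 2 *ℤ j +ℤ -1^ n) +ℤ + 2 *ℤ j
    ≡⟨ rearrange j (-1^ n) ⟩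
  + 2 *ℤ (+ 2 *ℤ j +ℤ -1^ n) +ℤ -1^ (suc n)
    ≡⟨ cong (λ a → + 2 *ℤ a +ℤ -1^ (suc n)) (jacobsthal-suc n) ⟨
  + 2 *ℤ + jacobsthal (suc n) +ℤ -1^ (suc n)
    ∎
  where
  j = + jacobsthal n
  rearrange : ∀ a s → (+ 2 *ℤ a +ℤ s) +ℤ + 2 *ℤ a ≡ + 2 *ℤ (+ 2 *ℤ a +ℤ s) +ℤ (ℤ.- + 1) *ℤ s
  rearrange = ℤ-Solver.solve-∀

2^≡jacobsthal : ∀ n → (+ 2) ℤ.^ n ≡ + (3 * jacobsthal n) +ℤ -1^ n
2^≡jacobsthal zero    = refl
2^≡jacobsthal (suc n) = begin
  + 2 *ℤ (+ 2) ℤ.^ n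
    ≡⟨ cong (+ 2 *ℤ_) (2^≡jacobsthal n) ⟩
  + 2 *ℤ (+ (3 * jacobsthal n) +ℤ -1^ n)
    ≡⟨ cong (λ a → + 2 *ℤ (a +ℤ -1^ n)) (ℤP.pos-* 3 (jacobsthal n)) ⟩
  + 2 *ℤ (+ 3 *ℤ j +ℤ -1^ n)
    ≡⟨ rearrange j (-1^ n) ⟩
  + 3 *ℤ (+ 2 *ℤ j +ℤ -1^ n) +ℤ -1^ (suc n)
    ≡⟨ cong (λ a → + 3 *ℤ a +ℤ -1^ (suc n)) (jacobsthal-suc n) ⟨
  + 3 *ℤ + jacobsthal (suc n) +ℤ -1^ (suc n)
    ≡⟨ cong (_+ℤ -1^ (suc n)) (ℤP.pos-* 3 (jacobsthal (suc n))) ⟨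
  + (3 * jacobsthal (suc n)) +ℤ -1^ (suc n)
    ∎
  where
  j = + jacobsthal n
  rearrange : ∀ a s → + 2 *ℤ (+ 3 *ℤ a +ℤ s) ≡ + 3 *ℤ (+ 2 *ℤ a +ℤ s) +ℤ (ℤ.- + 1) *ℤ s
  rearrange = ℤ-Solver.solve-∀

J≡jacobsthal : ∀ n → J n ≡ + jacobsthal n
J≡jacobsthal n = begin
  ((+ 2) ℤ.^ n ℤ.- -1^ n) ℤ./ + 3
    ≡⟨ cong (λ a → (a ℤ.- -1^ n) ℤ./ + 3) (2^≡jacobsthal n) ⟩
  ((+ (3 * jacobsthal n) +ℤ -1^ n) ℤ.- -1^ n) ℤ./ + 3
    ≡⟨ cong (ℤ._/ + 3) (cancel (+ (3 * jacobsthal n)) (-1^ n)) ⟩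
  + (3 * jacobsthal n) ℤ./ + 3
    ≡⟨ div-pos-is-/ℕ (+ (3 * jacobsthal n)) 3 ⟩
  + (3 * jacobsthal n ℕ./ 3)
    ≡⟨ cong +_ (trans (cong (ℕ._/ 3) (*-comm 3 (jacobsthal n))) (ℕ.m*n/n≡m (jacobsthal n) 3)) ⟩
  + jacobsthal n
    ∎
  where
  cancel : ∀ a s → (a +ℤ s) ℤ.- s ≡ a
  cancel = ℤ-Solver.solve-∀

J-recurrence : ∀ n → J (2 + n) ≡ + 4 *ℤ J n +ℤ -1^ n
J-recurrence n = begin
  J (2 + n)
    ≡⟨ J≡jacobsthal (2 + n) ⟩
  + jacobsthal (2 + n)
    ≡⟨ jacobsthal-suc (suc n) ⟩
  + 2 *ℤ + jacobsthal (suc n) +ℤ -1^ (suc n)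
    ≡⟨ cong (λ a → + 2 *ℤ a +ℤ -1^ (suc n)) (jacobsthal-suc n) ⟩
  + 2 *ℤ (+ 2 *ℤ + jacobsthal n +ℤ -1^ n) +ℤ -1^ (suc n)
    ≡⟨ rearrange (+ jacobsthal n) (-1^ n) ⟩
  + 4 *ℤ + jacobsthal n +ℤ -1^ n
    ≡⟨ cong (λ a → + 4 *ℤ a +ℤ -1^ n) (J≡jacobsthal n) ⟨
  + 4 *ℤ J n +ℤ -1^ n
    ∎
  where
  rearrange : ∀ a s → + 2 *ℤ (+ 2 *ℤ a +ℤ s) +ℤ (ℤ.- + 1) *ℤ s ≡ + 4 *ℤ a +ℤ s
  rearrange = ℤ-Solver.solve-∀

K-closed : ∀ n → + K (2 + n) ≡ + 2 *ℤ (J n +ℤ + 1)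
K-closed 0             = refl
K-closed 1             = refl
K-closed (suc (suc n)) = begin
  + K (4 + n)
    ≡⟨ K-recurrence n ⟩
  + 4 *ℤ + K (2 + n) ℤ.- + 2 *ℤ (+ 3 ℤ.- -1^ n)
    ≡⟨ cong (λ k → + 4 *ℤ k ℤ.- + 2 *ℤ (+ 3 ℤ.- -1^ n)) (K-closed n) ⟩
  + 4 *ℤ (+ 2 *ℤ (J n +ℤ + 1)) ℤ.- + 2 *ℤ (+ 3 ℤ.- -1^ n)
    ≡⟨ rearrange (J n) (-1^ n) ⟩
  + 2 *ℤ ((+ 4 *ℤ J n +ℤ -1^ n) +ℤ + 1)
    ≡⟨ cong (λ a → + 2 *ℤ (a +ℤ + 1)) (J-recurrence n) ⟨
  + 2 *ℤ (J (2 + n) +ℤ + 1)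
    ∎
  where
  rearrange : ∀ a s → + 4 *ℤ (+ 2 *ℤ (a +ℤ + 1)) ℤ.- + 2 *ℤ (+ 3 ℤ.- s) ≡ + 2 *ℤ ((+ 4 *ℤ a +ℤ s) +ℤ + 1)
  rearrange = ℤ-Solver.solve-∀

theorem6p6 : (n : ℕ) → + K (n + 2) ≡ + 2 *ℤ (J n +ℤ + 1)
theorem6p6 n = trans (cong (λ m → + K m) (+-comm n 2)) (K-closed n)
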